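{- For positive integers $i,j$ with $|i-j|\ge2$, we have $\mathfrak{t}_i\mathfrak{t}_j=\mathfrak{t}_j\mathfrak{t}_i$ as operators on compositions, i.e. $\mathfrak{t}_i(\mathfrak{t}_j(\alpha))=\mathfrak{t}_j(\mathfrak{t}_i(\alpha))$ for every composition $\alpha$.
   Context: A composition is a finite sequence $\alpha=(\alpha_1,\ldots,\alpha_k)$ of positive integers. Box-adding operators: $\mathfrak{t}_1(\alpha)=(1,\alpha_1,\ldots,\alpha_k)$; for $i\ge2$, $\mathfrak{t}_i(\alpha)$ is obtained from $\alpha$ by increasing by one the leftmost part of $\alpha$ equal to $i-1$ if such a part exists, and $\mathfrak{t}_i(\alpha)=0$ otherwise; also $\mathfrak{t}_i(0)=0$. -}

module Defs where

open import Data.Nat using (ℕ; zero; suc; _<_; _≟_)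
open import Data.List using (List; []; _∷_)
open import Data.List.Relation.Unary.All using (All)
open import Data.Maybe using (Maybe; just; nothing; _>>=_)
open import Relation.Nullary using (yes; no)

IsComposition : List ℕ → Set
IsComposition α = All (0 <_) α

incLeftmost : ℕ → List ℕ → Maybe (List ℕ)
incLeftmost k [] = nothing
incLeftmost k (a ∷ α) with a ≟ k
... | yes _ = just (suc a ∷ α)
... | no _ with incLeftmost k α
...   | nothing = nothing
...   | just β = just (a ∷ β)

-- Box-adding operator t_i on compositions; 'nothing' plays the role of 0.
-- t_0 is not used in the paper (i ranges over positive integers); it is set to 0.
t : ℕ → List ℕ → Maybe (List ℕ)
t zero α = nothing
t (suc zero) α = just (1 ∷ α)
t (suc (suc k)) α = incLeftmost (suc k) α

t₀ : ℕ → Maybe (List ℕ) → Maybe (List ℕ)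
t₀ i m = m >>= t i

-- For k ≥ 1, t_{k+1} acts on the first part equal to k.  Two such operators for
-- values a and b commute unless one of them creates a part equal to the value the
-- other is looking for, i.e. unless a and b differ by at most one.  t_1 only adds a
-- leading part 1, which t_j (j ≥ 3) skips over.
module Submission where

open import Defs
open import Data.Nat using (ℕ; suc; _≤_; _+_; _≟_)
open import Data.Nat.Properties using (<⇒≢; >⇒≢; ≤-trans; n≤1+n; m<n⇒m<1+n; +-comm)
open import Data.List using (List; []; _∷_)
open import Data.Maybe using (Maybe; just; nothing; _>>=_; map)
open import Data.Product using (_×_; _,_)
open import Data.Sum using (_⊎_; [_,_])
open import Data.Empty using (⊥-elim)
open import Relation.Nullary using (yes; no; Dec)
open import Relation.Binary.PropositionalEquality
  using (_≡_; _≢_; refl; sym; trans; cong; subst; ≢-sym; module ≡-Reasoning)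

Distant : ℕ → ℕ → Set
Distant a b = a ≢ b × suc a ≢ b × suc b ≢ a

Distant-sym : ∀ {a b} → Distant a b → Distant b a
Distant-sym (a≢b , 1+a≢b , 1+b≢a) = ≢-sym a≢b , 1+b≢a , 1+a≢b

Distant-pred : ∀ {a b} → Distant (suc a) (suc b) → Distant a b
Distant-pred (a≢b , 1+a≢b , 1+b≢a) =
  (λ e → a≢b (cong suc e)) , (λ e → 1+a≢b (cong suc e)) , (λ e → 1+b≢a (cong suc e))

+2≤⇒Distant : ∀ {a b} → a + 2 ≤ b → Distant a b
+2≤⇒Distant {a} {b} a+2≤b = <⇒≢ a<b , <⇒≢ 2+a≤b , >⇒≢ (m<n⇒m<1+n a<b)
  where
  2+a≤b : suc (suc a) ≤ b
  2+a≤b = subst (_≤ b) (+-comm a 2) a+2≤b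
  a<b : suc a ≤ b
  a<b = ≤-trans (n≤1+n (suc a)) 2+a≤b

incLeftmost-head-≡ : ∀ {k x} α → x ≡ k → incLeftmost k (x ∷ α) ≡ just (suc x ∷ α)
incLeftmost-head-≡ {k} {x} α x≡k with x ≟ k
... | yes _ = refl
... | no x≢k = ⊥-elim (x≢k x≡k)

incLeftmost-head-≢ : ∀ {k x} α → x ≢ k → incLeftmost k (x ∷ α) ≡ map (x ∷_) (incLeftmost k α)
incLeftmost-head-≢ {k} {x} α x≢k with x ≟ k
... | yes x≡k = ⊥-elim (x≢k x≡k)
... | no _ with incLeftmost k α
...   | nothing = refl
...   | just β = refl

map-∷->>=-incLeftmost-≡ : ∀ {k x} (m : Maybe (List ℕ)) → x ≡ k →
  (map (x ∷_) m >>= incLeftmost k) ≡ map (suc x ∷_) m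
map-∷->>=-incLeftmost-≡ nothing _ = refl
map-∷->>=-incLeftmost-≡ (just β) x≡k = incLeftmost-head-≡ β x≡k

map-∷->>=-incLeftmost-≢ : ∀ {k x} (m : Maybe (List ℕ)) → x ≢ k →
  (map (x ∷_) m >>= incLeftmost k) ≡ map (x ∷_) (m >>= incLeftmost k)
map-∷->>=-incLeftmost-≢ nothing _ = refl
map-∷->>=-incLeftmost-≢ (just β) x≢k = incLeftmost-head-≢ β x≢k

incLeftmost-comm-at-head : ∀ {a b} α → a ≢ b → suc a ≢ b →
  (incLeftmost a (a ∷ α) >>= incLeftmost b) ≡ (incLeftmost b (a ∷ α) >>= incLeftmost a)
incLeftmost-comm-at-head {a} {b} α a≢b 1+a≢b = begin
  (incLeftmost a (a ∷ α) >>= incLeftmost b)        ≡⟨ cong (_>>= incLeftmost b) (incLeftmost-head-≡ α refl) ⟩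
  incLeftmost b (suc a ∷ α)                        ≡⟨ incLeftmost-head-≢ α 1+a≢b ⟩
  map (suc a ∷_) (incLeftmost b α)                 ≡⟨ map-∷->>=-incLeftmost-≡ (incLeftmost b α) refl ⟨
  (map (a ∷_) (incLeftmost b α) >>= incLeftmost a) ≡⟨ cong (_>>= incLeftmost a) (incLeftmost-head-≢ α a≢b) ⟨
  (incLeftmost b (a ∷ α) >>= incLeftmost a)        ∎
  where open ≡-Reasoning

incLeftmost-comm : ∀ {a b} → Distant a b → (α : List ℕ) →
  (incLeftmost a α >>= incLeftmost b) ≡ (incLeftmost b α >>= incLeftmost a)
incLeftmost-comm d [] = refl
incLeftmost-comm {a} {b} d@(a≢b , 1+a≢b , 1+b≢a) (x ∷ α) = by-head (x ≟ a) (x ≟ b)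
  where
  open ≡-Reasoning
  by-head : Dec (x ≡ a) → Dec (x ≡ b) →
    (incLeftmost a (x ∷ α) >>= incLeftmost b) ≡ (incLeftmost b (x ∷ α) >>= incLeftmost a)
  by-head (yes refl) (yes refl) = ⊥-elim (a≢b refl)
  by-head (yes refl) (no x≢b) = incLeftmost-comm-at-head α x≢b 1+a≢b
  by-head (no x≢a) (yes refl) = sym (incLeftmost-comm-at-head α x≢a 1+b≢a)
  by-head (no x≢a) (no x≢b) = begin
    (incLeftmost a (x ∷ α) >>= incLeftmost b)        ≡⟨ cong (_>>= incLeftmost b) (incLeftmost-head-≢ α x≢a) ⟩
    (map (x ∷_) (incLeftmost a α) >>= incLeftmost b) ≡⟨ map-∷->>=-incLeftmost-≢ (incLeftmost a α) x≢b ⟩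
    map (x ∷_) (incLeftmost a α >>= incLeftmost b)   ≡⟨ cong (map (x ∷_)) (incLeftmost-comm d α) ⟩
    map (x ∷_) (incLeftmost b α >>= incLeftmost a)   ≡⟨ map-∷->>=-incLeftmost-≢ (incLeftmost b α) x≢a ⟨
    (map (x ∷_) (incLeftmost b α) >>= incLeftmost a) ≡⟨ cong (_>>= incLeftmost a) (incLeftmost-head-≢ α x≢b) ⟨
    (incLeftmost b (x ∷ α) >>= incLeftmost a)        ∎

>>=-t₁ : (m : Maybe (List ℕ)) → (m >>= t 1) ≡ map (1 ∷_) m
>>=-t₁ nothing = refl
>>=-t₁ (just α) = refl

incLeftmost-comm-t₁ : ∀ {k} → 1 ≢ k → (α : List ℕ) →
  (incLeftmost k α >>= t 1) ≡ incLeftmost k (1 ∷ α)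
incLeftmost-comm-t₁ {k} 1≢k α = trans (>>=-t₁ (incLeftmost k α)) (sym (incLeftmost-head-≢ α 1≢k))

t-comm : ∀ {i j} → 1 ≤ i → 1 ≤ j → Distant i j → (α : List ℕ) → t₀ i (t j α) ≡ t₀ j (t i α)
t-comm {1} {1} _ _ (1≢1 , _) _ = ⊥-elim (1≢1 refl)
t-comm {1} {2} _ _ (_ , 2≢2 , _) _ = ⊥-elim (2≢2 refl)
t-comm {1} {suc (suc (suc k))} _ _ _ α = incLeftmost-comm-t₁ (λ ()) α
t-comm {2} {1} _ _ (_ , _ , 2≢2) _ = ⊥-elim (2≢2 refl)
t-comm {suc (suc (suc k))} {1} _ _ _ α = sym (incLeftmost-comm-t₁ (λ ()) α)
t-comm {suc (suc a)} {suc (suc b)} _ _ d α = incLeftmost-comm (Distant-sym (Distant-pred d)) α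

lemma3p10 : (i j : ℕ) → 1 ≤ i → 1 ≤ j → (i + 2 ≤ j ⊎ j + 2 ≤ i) →
    (α : List ℕ) → IsComposition α →
    t₀ i (t j α) ≡ t₀ j (t i α)
lemma3p10 i j 1≤i 1≤j far α _ =
  t-comm 1≤i 1≤j ([ +2≤⇒Distant , (λ j+2≤i → Distant-sym (+2≤⇒Distant j+2≤i)) ] far) α
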